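{- Let $A$ be a pseudo-hoop and $\mu:A\to A$ a map. Then $\mu$ is a compatible type II state operator on $A$ if and only if $\mu$ is a compatible type I state operator on $A$ and ${\rm Ker}(\mu)=\{x\in A\mid\mu(x)=1\}$ is a fantastic filter of $A$.
   Context: A pseudo-hoop is an algebra $(A,\odot,\rightarrow,\rightsquigarrow,1)$ of type $(2,2,2,0)$ such that for all $x,y,z\in A$: $x\odot 1=1\odot x=x$; $x\rightarrow x=x\rightsquigarrow x=1$; $(x\odot y)\rightarrow z=x\rightarrow(y\rightarrow z)$; $(x\odot y)\rightsquigarrow z=y\rightsquigarrow(x\rightsquigarrow z)$; $(x\rightarrow y)\odot x=(y\rightarrow x)\odot y=x\odot(x\rightsquigarrow y)=y\odot(y\rightsquigarrow x)$. The order is $x\le y$ iff $x\rightarrow y=1$. Put $x\vee_1 y=(x\rightarrow y)\rightsquigarrow y$, $x\vee_2 y=(x\rightsquigarrow y)\rightarrow y$. For $\mu:A\to A$ and all $x,y$ consider: (IS1) $\mu(x\rightarrow y)=\mu(x\vee_1 y)\rightarrow\mu(y)$ and $\mu(x\rightsquigarrow y)=\mu(x\vee_2 y)\rightsquigarrow\mu(y)$; (IS1') $\mu(x\rightarrow y)=\mu(y\vee_1 x)\rightarrow\mu(y)$ and $\mu(x\rightsquigarrow y)=\mu(y\vee_2 x)\rightsquigarrow\mu(y)$; (IS2) $\mu(x\odot y)=\mu(x)\odot\mu(x\rightsquigarrow x\odot y)=\mu(y\rightarrow x\odot y)\odot\mu(y)$; (IS3) $\mu(\mu(x)\odot\mu(y))=\mu(x)\odot\mu(y)$;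 (IS4) $\mu(\mu(x)\rightarrow\mu(y))=\mu(x)\rightarrow\mu(y)$ and $\mu(\mu(x)\rightsquigarrow\mu(y))=\mu(x)\rightsquigarrow\mu(y)$. Type I: (IS1),(IS2),(IS3),(IS4); type II: (IS1'),(IS2),(IS3),(IS4). A filter is a nonempty $F\subseteq A$ closed under $\odot$ and upward closed; it is normal if for all $x,y$: $x\rightarrow y\in F$ iff $x\rightsquigarrow y\in F$; it is fantastic if for all $x,y$: $y\rightarrow x\in F$ implies $x\vee_1 y\rightarrow x\in F$, and $y\rightsquigarrow x\in F$ implies $x\vee_2 y\rightsquigarrow x\in F$. A state operator is compatible if its kernel is a normal filter. -}

module Defs where

open import Level using (Level; suc; _⊔_)
open import Data.Product using (Σ; _×_; _,_)
open import Relation.Binary.PropositionalEquality using (_≡_)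
open import Function.Bundles using (_⇔_)

record PseudoHoop (a : Level) : Set (suc a) where
  infixl 7 _⊙_
  infixr 5 _⇒_ _⇝_
  field
    Carrier : Set a
    _⊙_ : Carrier → Carrier → Carrier
    _⇒_ : Carrier → Carrier → Carrier
    _⇝_ : Carrier → Carrier → Carrier
    𝟏   : Carrier
    ⊙-identityʳ : ∀ x → x ⊙ 𝟏 ≡ x
    ⊙-identityˡ : ∀ x → 𝟏 ⊙ x ≡ x
    ⇒-refl : ∀ x → x ⇒ x ≡ 𝟏
    ⇝-refl : ∀ x → x ⇝ x ≡ 𝟏
    ⇒-curry : ∀ x y z → (x ⊙ y) ⇒ z ≡ x ⇒ (y ⇒ z)
    ⇝-curry : ∀ x y z → (x ⊙ y) ⇝ z ≡ y ⇝ (x ⇝ z)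
    divisibility₁ : ∀ x y → (x ⇒ y) ⊙ x ≡ (y ⇒ x) ⊙ y
    divisibility₂ : ∀ x y → (y ⇒ x) ⊙ y ≡ x ⊙ (x ⇝ y)
    divisibility₃ : ∀ x y → x ⊙ (x ⇝ y) ≡ y ⊙ (y ⇝ x)

  _≤_ : Carrier → Carrier → Set a
  x ≤ y = (x ⇒ y) ≡ 𝟏

  _∨₁_ : Carrier → Carrier → Carrier
  x ∨₁ y = (x ⇒ y) ⇝ y

  _∨₂_ : Carrier → Carrier → Carrier
  x ∨₂ y = (x ⇝ y) ⇒ y

module _ {a : Level} (A : PseudoHoop a) where
  open PseudoHoop A

  IS1 : (Carrier → Carrier) → Set a
  IS1 μ = ∀ x y → (μ (x ⇒ y) ≡ μ (x ∨₁ y) ⇒ μ y) × (μ (x ⇝ y) ≡ μ (x ∨₂ y) ⇝ μ y)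

  IS1' : (Carrier → Carrier) → Set a
  IS1' μ = ∀ x y → (μ (x ⇒ y) ≡ μ (y ∨₁ x) ⇒ μ y) × (μ (x ⇝ y) ≡ μ (y ∨₂ x) ⇝ μ y)

  IS2 : (Carrier → Carrier) → Set a
  IS2 μ = ∀ x y → (μ (x ⊙ y) ≡ μ x ⊙ μ (x ⇝ x ⊙ y)) × (μ x ⊙ μ (x ⇝ x ⊙ y) ≡ μ (y ⇒ x ⊙ y) ⊙ μ y)

  IS3 : (Carrier → Carrier) → Set a
  IS3 μ = ∀ x y → μ (μ x ⊙ μ y) ≡ μ x ⊙ μ y

  IS4 : (Carrier → Carrier) → Set a
  IS4 μ = ∀ x y → (μ (μ x ⇒ μ y) ≡ μ x ⇒ μ y) × (μ (μ x ⇝ μ y) ≡ μ x ⇝ μ y)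

  IsTypeIStateOperator : (Carrier → Carrier) → Set a
  IsTypeIStateOperator μ = IS1 μ × IS2 μ × IS3 μ × IS4 μ

  IsTypeIIStateOperator : (Carrier → Carrier) → Set a
  IsTypeIIStateOperator μ = IS1' μ × IS2 μ × IS3 μ × IS4 μ

  Subset : (ℓ : Level) → Set (a ⊔ suc ℓ)
  Subset ℓ = Carrier → Set ℓ

  IsFilter : {ℓ : Level} → Subset ℓ → Set (a ⊔ ℓ)
  IsFilter F = Σ Carrier F
             × (∀ x y → F x → F y → F (x ⊙ y))
             × (∀ x y → x ≤ y → F x → F y)

  IsNormalFilter : {ℓ : Level} → Subset ℓ → Set (a ⊔ ℓ)
  IsNormalFilter F = IsFilter F × (∀ x y → F (x ⇒ y) ⇔ F (x ⇝ y))

  IsFantasticFilter : {ℓ : Level} → Subset ℓ → Set (a ⊔ ℓ)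
  IsFantasticFilter F = IsFilter F
    × (∀ x y → F (y ⇒ x) → F ((x ∨₁ y) ⇒ x))
    × (∀ x y → F (y ⇝ x) → F ((x ∨₂ y) ⇝ x))

  Ker : (Carrier → Carrier) → Subset a
  Ker μ x = μ x ≡ 𝟏

  IsCompatible : (Carrier → Carrier) → Set a
  IsCompatible μ = IsNormalFilter (Ker μ)

  IsCompatibleTypeIStateOperator : (Carrier → Carrier) → Set a
  IsCompatibleTypeIStateOperator μ = IsTypeIStateOperator μ × IsCompatible μ

  IsCompatibleTypeIIStateOperator : (Carrier → Carrier) → Set a
  IsCompatibleTypeIIStateOperator μ = IsTypeIIStateOperator μ × IsCompatible μ

-- Each IS1' instance with
-- y ≤ x reads μ(x → y) = μ x → μ y, which yields IS1 by the absorption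
-- (x ∨₁ y) → y = x → y, and, together with IS1' at (y, x), the fantastic condition.
-- Conversely, the fantastic condition applied to x ≤ x ∨₁ y forces
-- μ((x ∨₁ y) ∨₁ x) ≤ μ(x ∨₁ y); since y ∨₁ x ≤ (x ∨₁ y) ∨₁ x and μ is monotone,
-- μ(y ∨₁ x) ≤ μ(x ∨₁ y), so μ(x ∨₁ y) = μ(y ∨₁ x) and IS1 becomes IS1'.
module Submission where

open import Defs
open import Level using (Level)
open import Data.Product using (_×_; _,_; proj₁; proj₂)
open import Function.Bundles using (_⇔_; mk⇔; Equivalence)
open import Relation.Binary.PropositionalEquality
  using (_≡_; sym; trans; cong; subst; module ≡-Reasoning)

open Equivalence using (to; from)

module PseudoHoopProperties {a : Level} (A : PseudoHoop a) where
  open PseudoHoop A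
  open ≡-Reasoning

  ≤-refl : ∀ {x} → x ≤ x
  ≤-refl {x} = ⇒-refl x

  ≤-antisym : ∀ {x y} → x ≤ y → y ≤ x → x ≡ y
  ≤-antisym {x} {y} x≤y y≤x = begin
    x                ≡⟨ ⊙-identityˡ x ⟨
    𝟏 ⊙ x            ≡⟨ cong (_⊙ x) x≤y ⟨
    (x ⇒ y) ⊙ x      ≡⟨ divisibility₁ x y ⟩
    (y ⇒ x) ⊙ y      ≡⟨ cong (_⊙ y) y≤x ⟩
    𝟏 ⊙ y            ≡⟨ ⊙-identityˡ y ⟩
    y                ∎

  private
    [x⇒𝟏]⊙x≡𝟏⇒x : ∀ x → (x ⇒ 𝟏) ⊙ x ≡ 𝟏 ⇒ x
    [x⇒𝟏]⊙x≡𝟏⇒x x = trans (divisibility₁ x 𝟏) (⊙-identityʳ (𝟏 ⇒ x))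

    fixed-by-𝟏⇒⇒≤𝟏 : ∀ w → 𝟏 ⇒ w ≡ w → w ≤ 𝟏
    fixed-by-𝟏⇒⇒≤𝟏 w 𝟏⇒w≡w = begin
      w ⇒ 𝟏                  ≡⟨ cong (_⇒ 𝟏) (trans ([x⇒𝟏]⊙x≡𝟏⇒x w) 𝟏⇒w≡w) ⟨
      ((w ⇒ 𝟏) ⊙ w) ⇒ 𝟏      ≡⟨ ⇒-curry (w ⇒ 𝟏) w 𝟏 ⟩
      (w ⇒ 𝟏) ⇒ (w ⇒ 𝟏)      ≡⟨ ⇒-refl (w ⇒ 𝟏) ⟩
      𝟏                      ∎

  ⇒-identityˡ : ∀ x → 𝟏 ⇒ x ≡ x
  ⇒-identityˡ x = ≤-antisym 𝟏⇒x≤x x≤𝟏⇒x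
    where
    x≤𝟏⇒x : x ≤ (𝟏 ⇒ x)
    x≤𝟏⇒x = trans (sym (⇒-curry x 𝟏 x)) (trans (cong (_⇒ x) (⊙-identityʳ x)) (⇒-refl x))

    𝟏⇒x≤x : (𝟏 ⇒ x) ≤ x
    𝟏⇒x≤x = begin
      (𝟏 ⇒ x) ⇒ x              ≡⟨ cong (_⇒ x) ([x⇒𝟏]⊙x≡𝟏⇒x x) ⟨
      ((x ⇒ 𝟏) ⊙ x) ⇒ x        ≡⟨ ⇒-curry (x ⇒ 𝟏) x x ⟩
      (x ⇒ 𝟏) ⇒ (x ⇒ x)        ≡⟨ cong ((x ⇒ 𝟏) ⇒_) (⇒-refl x) ⟩
      (x ⇒ 𝟏) ⇒ 𝟏              ≡⟨ fixed-by-𝟏⇒⇒≤𝟏 (x ⇒ 𝟏) 𝟏⇒[x⇒𝟏]≡x⇒𝟏 ⟩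
      𝟏                        ∎
      where
      𝟏⇒[x⇒𝟏]≡x⇒𝟏 : 𝟏 ⇒ (x ⇒ 𝟏) ≡ x ⇒ 𝟏
      𝟏⇒[x⇒𝟏]≡x⇒𝟏 = trans (sym (⇒-curry 𝟏 x 𝟏)) (cong (_⇒ 𝟏) (⊙-identityˡ x))

  ⇒-zeroʳ : ∀ x → x ⇒ 𝟏 ≡ 𝟏
  ⇒-zeroʳ x = fixed-by-𝟏⇒⇒≤𝟏 x (⇒-identityˡ x)

  ⇝-identityˡ : ∀ x → 𝟏 ⇝ x ≡ x
  ⇝-identityˡ x = begin
    𝟏 ⇝ x            ≡⟨ ⊙-identityˡ (𝟏 ⇝ x) ⟨
    𝟏 ⊙ (𝟏 ⇝ x)      ≡⟨ divisibility₃ x 𝟏 ⟨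
    x ⊙ (x ⇝ 𝟏)      ≡⟨ divisibility₂ x 𝟏 ⟨
    (𝟏 ⇒ x) ⊙ 𝟏      ≡⟨ ⊙-identityʳ (𝟏 ⇒ x) ⟩
    𝟏 ⇒ x            ≡⟨ ⇒-identityˡ x ⟩
    x                ∎

  ⇝-zeroʳ : ∀ x → x ⇝ 𝟏 ≡ 𝟏
  ⇝-zeroʳ x = begin
    x ⇝ 𝟏                      ≡⟨ cong (_⇝ 𝟏) x⊙[x⇝𝟏]≡x ⟨
    (x ⊙ (x ⇝ 𝟏)) ⇝ 𝟏          ≡⟨ ⇝-curry x (x ⇝ 𝟏) 𝟏 ⟩
    (x ⇝ 𝟏) ⇝ (x ⇝ 𝟏)          ≡⟨ ⇝-refl (x ⇝ 𝟏) ⟩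
    𝟏                          ∎
    where
    x⊙[x⇝𝟏]≡x : x ⊙ (x ⇝ 𝟏) ≡ x
    x⊙[x⇝𝟏]≡x = trans (divisibility₃ x 𝟏) (trans (⊙-identityˡ (𝟏 ⇝ x)) (⇝-identityˡ x))

  x⊙y≤y : ∀ x y → (x ⊙ y) ≤ y
  x⊙y≤y x y = trans (⇒-curry x y y) (trans (cong (x ⇒_) (⇒-refl y)) (⇒-zeroʳ x))

  ≤⇒[y⇒x]⊙y≡x : ∀ {x y} → x ≤ y → (y ⇒ x) ⊙ y ≡ x
  ≤⇒[y⇒x]⊙y≡x {x} {y} x≤y = begin
    (y ⇒ x) ⊙ y      ≡⟨ divisibility₁ x y ⟨
    (x ⇒ y) ⊙ x      ≡⟨ cong (_⊙ x) x≤y ⟩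
    𝟏 ⊙ x            ≡⟨ ⊙-identityˡ x ⟩
    x                ∎

  ≤⇒y⊙[y⇝x]≡x : ∀ {x y} → x ≤ y → y ⊙ (y ⇝ x) ≡ x
  ≤⇒y⊙[y⇝x]≡x {x} {y} x≤y = begin
    y ⊙ (y ⇝ x)      ≡⟨ divisibility₃ x y ⟨
    x ⊙ (x ⇝ y)      ≡⟨ divisibility₂ x y ⟨
    (y ⇒ x) ⊙ y      ≡⟨ ≤⇒[y⇒x]⊙y≡x x≤y ⟩
    x                ∎

  ≤⇒⇝≡𝟏 : ∀ {x y} → x ≤ y → x ⇝ y ≡ 𝟏
  ≤⇒⇝≡𝟏 {x} {y} x≤y = begin
    x ⇝ y                      ≡⟨ cong (_⇝ y) (≤⇒y⊙[y⇝x]≡x x≤y) ⟨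
    (y ⊙ (y ⇝ x)) ⇝ y          ≡⟨ ⇝-curry y (y ⇝ x) y ⟩
    (y ⇝ x) ⇝ (y ⇝ y)          ≡⟨ cong ((y ⇝ x) ⇝_) (⇝-refl y) ⟩
    (y ⇝ x) ⇝ 𝟏                ≡⟨ ⇝-zeroʳ (y ⇝ x) ⟩
    𝟏                          ∎

  ⇝≡𝟏⇒≤ : ∀ {x y} → x ⇝ y ≡ 𝟏 → x ≤ y
  ⇝≡𝟏⇒≤ {x} {y} x⇝y≡𝟏 = subst (_≤ y) [y⇒x]⊙y≡x (x⊙y≤y (y ⇒ x) y)
    where
    [y⇒x]⊙y≡x : (y ⇒ x) ⊙ y ≡ x
    [y⇒x]⊙y≡x = trans (divisibility₂ x y) (trans (cong (x ⊙_) x⇝y≡𝟏) (⊙-identityʳ x))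

  x⊙y≤x : ∀ x y → (x ⊙ y) ≤ x
  x⊙y≤x x y = ⇝≡𝟏⇒≤ (trans (⇝-curry x y x) (trans (cong (y ⇝_) (⇝-refl x)) (⇝-zeroʳ y)))

  ≤-trans : ∀ {x y z} → x ≤ y → y ≤ z → x ≤ z
  ≤-trans {x} {y} {z} x≤y y≤z = begin
    x ⇒ z                      ≡⟨ cong (_⇒ z) (≤⇒[y⇒x]⊙y≡x x≤y) ⟨
    ((y ⇒ x) ⊙ y) ⇒ z          ≡⟨ ⇒-curry (y ⇒ x) y z ⟩
    (y ⇒ x) ⇒ (y ⇒ z)          ≡⟨ cong ((y ⇒ x) ⇒_) y≤z ⟩
    (y ⇒ x) ⇒ 𝟏                ≡⟨ ⇒-zeroʳ (y ⇒ x) ⟩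
    𝟏                          ∎

  ⊙-⇒-residuated : ∀ {x y z} → (x ⊙ y) ≤ z ⇔ x ≤ (y ⇒ z)
  ⊙-⇒-residuated {x} {y} {z} = mk⇔ (trans (sym (⇒-curry x y z))) (trans (⇒-curry x y z))

  ⊙-⇝-residuated : ∀ {x y z} → (x ⊙ y) ≤ z ⇔ y ≤ (x ⇝ z)
  ⊙-⇝-residuated {x} {y} {z} = mk⇔
    (λ x⊙y≤z → ⇝≡𝟏⇒≤ (trans (sym (⇝-curry x y z)) (≤⇒⇝≡𝟏 x⊙y≤z)))
    (λ y≤x⇝z → ⇝≡𝟏⇒≤ (trans (⇝-curry x y z) (≤⇒⇝≡𝟏 y≤x⇝z)))

  ⇒-mp : ∀ x y → ((x ⇒ y) ⊙ x) ≤ y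
  ⇒-mp x y = from ⊙-⇒-residuated ≤-refl

  ⇝-mp : ∀ x y → (x ⊙ (x ⇝ y)) ≤ y
  ⇝-mp x y = from ⊙-⇝-residuated ≤-refl

  ⊙-monoʳ-≤ : ∀ x {y z} → y ≤ z → (x ⊙ y) ≤ (x ⊙ z)
  ⊙-monoʳ-≤ x {y} {z} y≤z = from ⊙-⇝-residuated (≤-trans y≤z (to ⊙-⇝-residuated ≤-refl))

  ⊙-monoˡ-≤ : ∀ x {y z} → y ≤ z → (y ⊙ x) ≤ (z ⊙ x)
  ⊙-monoˡ-≤ x {y} {z} y≤z = from ⊙-⇒-residuated (≤-trans y≤z (to ⊙-⇒-residuated ≤-refl))

  ⇒-antitoneˡ-≤ : ∀ z {x y} → x ≤ y → (y ⇒ z) ≤ (x ⇒ z)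
  ⇒-antitoneˡ-≤ z {x} {y} x≤y =
    to ⊙-⇒-residuated (≤-trans (⊙-monoʳ-≤ (y ⇒ z) x≤y) (⇒-mp y z))

  ⇝-antitoneˡ-≤ : ∀ z {x y} → x ≤ y → (y ⇝ z) ≤ (x ⇝ z)
  ⇝-antitoneˡ-≤ z {x} {y} x≤y =
    to ⊙-⇝-residuated (≤-trans (⊙-monoˡ-≤ (y ⇝ z) x≤y) (⇝-mp y z))

  x≤x∨₁y : ∀ x y → x ≤ (x ∨₁ y)
  x≤x∨₁y x y = to ⊙-⇝-residuated (⇒-mp x y)

  y≤x∨₁y : ∀ x y → y ≤ (x ∨₁ y)
  y≤x∨₁y x y = to ⊙-⇝-residuated (x⊙y≤y (x ⇒ y) y)

  x≤x∨₂y : ∀ x y → x ≤ (x ∨₂ y)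
  x≤x∨₂y x y = to ⊙-⇒-residuated (⇝-mp x y)

  y≤x∨₂y : ∀ x y → y ≤ (x ∨₂ y)
  y≤x∨₂y x y = to ⊙-⇒-residuated (x⊙y≤x y (x ⇝ y))

  ∨₁-monoˡ-≤ : ∀ z {x y} → x ≤ y → (x ∨₁ z) ≤ (y ∨₁ z)
  ∨₁-monoˡ-≤ z x≤y = ⇝-antitoneˡ-≤ z (⇒-antitoneˡ-≤ z x≤y)

  ∨₂-monoˡ-≤ : ∀ z {x y} → x ≤ y → (x ∨₂ z) ≤ (y ∨₂ z)
  ∨₂-monoˡ-≤ z x≤y = ⇒-antitoneˡ-≤ z (⇝-antitoneˡ-≤ z x≤y)

  ∨₁-⇒-absorb : ∀ x y → (x ∨₁ y) ⇒ y ≡ x ⇒ y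
  ∨₁-⇒-absorb x y = ≤-antisym (⇒-antitoneˡ-≤ y (x≤x∨₁y x y))
                              (to ⊙-⇒-residuated (⇝-mp (x ⇒ y) y))

  ∨₂-⇝-absorb : ∀ x y → (x ∨₂ y) ⇝ y ≡ x ⇝ y
  ∨₂-⇝-absorb x y = ≤-antisym (⇝-antitoneˡ-≤ y (x≤x∨₂y x y))
                              (to ⊙-⇝-residuated (⇒-mp (x ⇝ y) y))

  x≤y⇒x∨₁y≡y : ∀ {x y} → x ≤ y → x ∨₁ y ≡ y
  x≤y⇒x∨₁y≡y {x} {y} x≤y = trans (cong (_⇝ y) x≤y) (⇝-identityˡ y)

  x≤y⇒x∨₂y≡y : ∀ {x y} → x ≤ y → x ∨₂ y ≡ y
  x≤y⇒x∨₂y≡y {x} {y} x≤y = trans (cong (_⇒ y) (≤⇒⇝≡𝟏 x≤y)) (⇒-identityˡ y)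

  𝟏∈filter : ∀ {ℓ} {F : Subset A ℓ} → IsFilter A F → F 𝟏
  𝟏∈filter ((x , x∈F) , _ , upward) = upward x 𝟏 (⇒-zeroʳ x) x∈F

module StateOperatorProperties
  {a : Level} (A : PseudoHoop a) (μ : PseudoHoop.Carrier A → PseudoHoop.Carrier A) where
  open PseudoHoop A
  open PseudoHoopProperties A
  open ≡-Reasoning

  IS2⇒monotone : IS2 A μ → ∀ {x y} → x ≤ y → μ x ≤ μ y
  IS2⇒monotone is2 {x} {y} x≤y = subst (_≤ μ y) μ-factor (x⊙y≤x (μ y) _)
    where
    μ-factor : μ y ⊙ μ (y ⇝ y ⊙ (y ⇝ x)) ≡ μ x
    μ-factor = trans (sym (proj₁ (is2 y (y ⇝ x)))) (cong μ (≤⇒y⊙[y⇝x]≡x x≤y))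

  module _ (is1 : IS1 A μ) (is2 : IS2 A μ) where

    μ⇒≡𝟏⇒≤ : ∀ {x y} → μ (x ⇒ y) ≡ 𝟏 → μ x ≤ μ y
    μ⇒≡𝟏⇒≤ {x} {y} μ[x⇒y]≡𝟏 =
      ≤-trans (IS2⇒monotone is2 (x≤x∨₁y x y)) (trans (sym (proj₁ (is1 x y))) μ[x⇒y]≡𝟏)

    μ⇝≡𝟏⇒≤ : ∀ {x y} → μ (x ⇝ y) ≡ 𝟏 → μ x ≤ μ y
    μ⇝≡𝟏⇒≤ {x} {y} μ[x⇝y]≡𝟏 =
      ≤-trans (IS2⇒monotone is2 (x≤x∨₂y x y)) (⇝≡𝟏⇒≤ (trans (sym (proj₂ (is1 x y))) μ[x⇝y]≡𝟏))

    module _ (fantastic : IsFantasticFilter A (Ker A μ)) where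
      private
        μ𝟏≡𝟏 : μ 𝟏 ≡ 𝟏
        μ𝟏≡𝟏 = 𝟏∈filter (proj₁ fantastic)

        μ-∨₁-flip-≤ : ∀ x y → μ (y ∨₁ x) ≤ μ (x ∨₁ y)
        μ-∨₁-flip-≤ x y = ≤-trans (IS2⇒monotone is2 y∨₁x≤u∨₁x) (μ⇒≡𝟏⇒≤ μ[u∨₁x⇒u]≡𝟏)
          where
          u : Carrier
          u = x ∨₁ y

          y∨₁x≤u∨₁x : (y ∨₁ x) ≤ (u ∨₁ x)
          y∨₁x≤u∨₁x = ∨₁-monoˡ-≤ x (y≤x∨₁y x y)

          μ[u∨₁x⇒u]≡𝟏 : μ ((u ∨₁ x) ⇒ u) ≡ 𝟏
          μ[u∨₁x⇒u]≡𝟏 = proj₁ (proj₂ fantastic) u x (subst (Ker A μ) (sym (x≤x∨₁y x y)) μ𝟏≡𝟏)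

        μ-∨₂-flip-≤ : ∀ x y → μ (y ∨₂ x) ≤ μ (x ∨₂ y)
        μ-∨₂-flip-≤ x y = ≤-trans (IS2⇒monotone is2 y∨₂x≤u∨₂x) (μ⇝≡𝟏⇒≤ μ[u∨₂x⇝u]≡𝟏)
          where
          u : Carrier
          u = x ∨₂ y

          y∨₂x≤u∨₂x : (y ∨₂ x) ≤ (u ∨₂ x)
          y∨₂x≤u∨₂x = ∨₂-monoˡ-≤ x (y≤x∨₂y x y)

          μ[u∨₂x⇝u]≡𝟏 : μ ((u ∨₂ x) ⇝ u) ≡ 𝟏
          μ[u∨₂x⇝u]≡𝟏 =
            proj₂ (proj₂ fantastic) u x (subst (Ker A μ) (sym (≤⇒⇝≡𝟏 (x≤x∨₂y x y))) μ𝟏≡𝟏)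

      μ-∨₁-comm : ∀ x y → μ (x ∨₁ y) ≡ μ (y ∨₁ x)
      μ-∨₁-comm x y = ≤-antisym (μ-∨₁-flip-≤ y x) (μ-∨₁-flip-≤ x y)

      μ-∨₂-comm : ∀ x y → μ (x ∨₂ y) ≡ μ (y ∨₂ x)
      μ-∨₂-comm x y = ≤-antisym (μ-∨₂-flip-≤ y x) (μ-∨₂-flip-≤ x y)

      IS1∧fantastic⇒IS1' : IS1' A μ
      IS1∧fantastic⇒IS1' x y =
        trans (proj₁ (is1 x y)) (cong (_⇒ μ y) (μ-∨₁-comm x y)) ,
        trans (proj₂ (is1 x y)) (cong (_⇝ μ y) (μ-∨₂-comm x y))

  module _ (is1' : IS1' A μ) where

    μ-⇒-of-≤ : ∀ {x y} → y ≤ x → μ (x ⇒ y) ≡ μ x ⇒ μ y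
    μ-⇒-of-≤ {x} {y} y≤x = trans (proj₁ (is1' x y)) (cong (λ z → μ z ⇒ μ y) (x≤y⇒x∨₁y≡y y≤x))

    μ-⇝-of-≤ : ∀ {x y} → y ≤ x → μ (x ⇝ y) ≡ μ x ⇝ μ y
    μ-⇝-of-≤ {x} {y} y≤x = trans (proj₂ (is1' x y)) (cong (λ z → μ z ⇝ μ y) (x≤y⇒x∨₂y≡y y≤x))

    IS1'⇒IS1 : IS1 A μ
    IS1'⇒IS1 x y =
      trans (cong μ (sym (∨₁-⇒-absorb x y))) (μ-⇒-of-≤ (y≤x∨₁y x y)) ,
      trans (cong μ (sym (∨₂-⇝-absorb x y))) (μ-⇝-of-≤ (y≤x∨₂y x y))

    IS1'⇒fantastic-ker : IsFilter A (Ker A μ) → IsFantasticFilter A (Ker A μ)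
    IS1'⇒fantastic-ker filter = filter , fantastic₁ , fantastic₂
      where
      fantastic₁ : ∀ x y → μ (y ⇒ x) ≡ 𝟏 → μ ((x ∨₁ y) ⇒ x) ≡ 𝟏
      fantastic₁ x y μ[y⇒x]≡𝟏 = begin
        μ ((x ∨₁ y) ⇒ x)     ≡⟨ μ-⇒-of-≤ (x≤x∨₁y x y) ⟩
        μ (x ∨₁ y) ⇒ μ x     ≡⟨ proj₁ (is1' y x) ⟨
        μ (y ⇒ x)            ≡⟨ μ[y⇒x]≡𝟏 ⟩
        𝟏                    ∎

      fantastic₂ : ∀ x y → μ (y ⇝ x) ≡ 𝟏 → μ ((x ∨₂ y) ⇝ x) ≡ 𝟏
      fantastic₂ x y μ[y⇝x]≡𝟏 = begin
        μ ((x ∨₂ y) ⇝ x)     ≡⟨ μ-⇝-of-≤ (x≤x∨₂y x y) ⟩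
        μ (x ∨₂ y) ⇝ μ x     ≡⟨ proj₂ (is1' y x) ⟨
        μ (y ⇝ x)            ≡⟨ μ[y⇝x]≡𝟏 ⟩
        𝟏                    ∎

theorem5p17 : {a : Level} (A : PseudoHoop a) (μ : PseudoHoop.Carrier A → PseudoHoop.Carrier A) →
    IsCompatibleTypeIIStateOperator A μ ⇔ (IsCompatibleTypeIStateOperator A μ × IsFantasticFilter A (Ker A μ))
theorem5p17 A μ = mk⇔ typeII⇒typeI∧fantastic typeI∧fantastic⇒typeII
  where
  open StateOperatorProperties A μ

  typeII⇒typeI∧fantastic : IsCompatibleTypeIIStateOperator A μ →
                           IsCompatibleTypeIStateOperator A μ × IsFantasticFilter A (Ker A μ)
  typeII⇒typeI∧fantastic ((is1' , is2 , is3 , is4) , normal) =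
    ((IS1'⇒IS1 is1' , is2 , is3 , is4) , normal) ,
    IS1'⇒fantastic-ker is1' (proj₁ normal)

  typeI∧fantastic⇒typeII : IsCompatibleTypeIStateOperator A μ × IsFantasticFilter A (Ker A μ) →
                           IsCompatibleTypeIIStateOperator A μ
  typeI∧fantastic⇒typeII (((is1 , is2 , is3 , is4) , normal) , fantastic) =
    (IS1∧fantastic⇒IS1' is1 is2 fantastic , is2 , is3 , is4) , normal
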